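{- Let $n\ge0$ and $0\le i<3^n$. If $C_n(i)\neq 1$ and $C_n(i)$ is not a strict local maximum of $C_n$, then $(C_{n+1}(3i),C_{n+1}(3i+1),C_{n+1}(3i+2))=(C_n(i)/3,C_n(i)/3,C_n(i)/3)$.
   Context: The unit weight-$3$ Stern–Brocot sequences $SB_n$ ($n\ge0$): $SB_0=(\frac{0}{1},\frac{1}{1})$, and $SB_{n+1}$ is obtained from $SB_n$ by keeping all its terms in order and inserting, between each pair of consecutive terms $\frac{p}{q},\frac{r}{s}$ (in lowest terms, positive denominators), the two fractions $\frac{2p+r}{2q+s}$ and $\frac{p+2r}{q+2s}$, each reduced to lowest terms, in this order. $SB_n$ has $3^n+1$ terms, indexed from $0$. For $0\le i<3^n$, $C_n(i)=qr-ps$ where $\frac{p}{q}$ and $\frac{r}{s}$ are the $i$-th and $(i+1)$-th terms of $SB_n$ in lowest terms with positive denominators. $C_n(i)$ is a strict local maximum if $C_n(i)>C_n(j)$ for each $j\in\{i-1,i+1\}$ with $0\le j<3^n$. -}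

module Defs where

open import Data.Nat using (ℕ; zero; suc; _+_; _*_; _∸_; _^_; _<_; _≤_)
open import Data.Nat.DivMod using (_/_)
open import Data.Nat.GCD using (gcd)
open import Data.Integer as ℤ using (ℤ; +_)
open import Data.Product using (_×_; _,_)
open import Data.List using (List; []; _∷_)
open import Relation.Binary.PropositionalEquality using (_≡_)

-- A fraction p/q is represented by the pair (p , q) of naturals
-- (all terms of SB_n lie in [0,1], so numerators are nonnegative).
Frac : Set
Frac = ℕ × ℕ

-- m divided by d (d = 0 never occurs for positive denominators).
divBy : ℕ → ℕ → ℕ
divBy m zero    = m
divBy m (suc k) = m / suc k

reduce : Frac → Frac
reduce (p , q) = divBy p (gcd p q) , divBy q (gcd p q)

left right : Frac → Frac → Frac
left  (p , q) (r , s) = reduce (2 * p + r , 2 * q + s)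
right (p , q) (r , s) = reduce (p + 2 * r , q + 2 * s)

refine : List Frac → List Frac
refine []                   = []
refine (x ∷ [])             = x ∷ []
refine (x ∷ ys@(y ∷ rest))  = x ∷ left x y ∷ right x y ∷ refine ys

SB : ℕ → List Frac
SB zero    = (0 , 1) ∷ (1 , 1) ∷ []
SB (suc n) = refine (SB n)

-- i-th entry of a list (default (0,1) outside range; only used in range)
nth : List Frac → ℕ → Frac
nth []       _       = 0 , 1
nth (x ∷ xs) zero    = x
nth (x ∷ xs) (suc i) = nth xs i

C : ℕ → ℕ → ℤ
C n i with nth (SB n) i | nth (SB n) (suc i)
... | (p , q) | (r , s) = (+ (q * r)) ℤ.- (+ (p * s))

StrictLocalMax : ℕ → ℕ → Set
StrictLocalMax n i =
  ((j : ℕ) → suc j ≡ i → C n j ℤ.< C n i) ×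
  (suc i < 3 ^ n → C n (suc i) ℤ.< C n i)

{-# OPTIONS --safe #-}
-- Write a consecutive pair p/q, r/s of SB n as the integer vectors x = (p , q) and y = (r , s). In a
-- frame (v , x) with cross x v = 1, the vector y has coordinates (3^k , 1) (shape plus k) or
-- (3^(k+1) , -1) (shape minus k), and correspondingly C = 3^k or 3^(k+1). Refinement commutes with
-- unimodular changes of frame (they preserve primitivity, so also the reduction to lowest terms), so the
-- children of a pair are read off from those of its standard pair: plus (k+1) splits into three plus k,
-- plus 0 into plus 0, minus 0, plus 0, and minus k into plus (k+1), minus (k+1), plus (k+1). Hence every
-- minus pair is flanked by plus pairs with a third of its value, so it is a strict local maximum; a pair
-- with C ≠ 1 which is not a strict local maximum has shape plus (k+1), and its three children have C = 3^k.
module Submission where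

open import Defs
open import Data.Nat using (ℕ; _<_; _^_; _*_; _+_)
open import Data.Integer as ℤ using (+_)
open import Relation.Binary.PropositionalEquality using (_≡_; _≢_)
open import Relation.Nullary using (¬_)
open import Data.Product using (_×_)

open import Data.Nat using (zero; suc; _≤_; s≤s; z≤n)
open import Data.Nat.Properties
  using (*-comm; *-identityʳ; +-comm; +-assoc; *-suc; +-suc; +-identityʳ; suc-injective; <⇒≤; <-trans; n<1+n; ^-monoʳ-<)
open import Data.Nat.DivMod using (_/_; m*n/n≡m)
open import Data.Nat.GCD using (gcd; gcd[m,n]∣m; gcd[m,n]∣n; c*gcd[m,n]≡gcd[cm,cn])
open import Data.Nat.Divisibility using (∣1⇒≡1)
open import Data.Integer using (ℤ; -[1+_]; -1ℤ)
  renaming (_+_ to _+ᶻ_; _*_ to _*ᶻ_; _-_ to _-ᶻ_)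
open import Data.Integer.Properties
  using (pos-*; pos-+; +-injective) renaming (*-identityʳ to *ᶻ-identityʳ)
open import Data.Integer.Divisibility.Signed using (_∣_; ∣ᵤ⇒∣; ∣⇒∣ᵤ; ∣m∣n⇒∣m-n; ∣m⇒∣m*n)
open import Data.Integer.Tactic.RingSolver using (solve-∀)
open import Data.Product using (_,_; proj₁; proj₂)
open import Data.List using (List; []; _∷_; length)
open import Data.Unit using (⊤; tt)
open import Data.Empty using (⊥; ⊥-elim)
open import Relation.Binary.PropositionalEquality
  using (refl; sym; trans; cong; cong₂; subst; subst₂; module ≡-Reasoning)
open ≡-Reasoning

ℤ² : Set
ℤ² = ℤ × ℤ

infixl 6 _⊕_
infixr 7 _·_

_⊕_ : ℤ² → ℤ² → ℤ²
(a , b) ⊕ (c , d) = a +ᶻ c , b +ᶻ d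

_·_ : ℤ → ℤ² → ℤ²
s · (a , b) = s *ᶻ a , s *ᶻ b

cross : ℤ² → ℤ² → ℤ
cross (p , q) (r , s) = q *ᶻ r -ᶻ p *ᶻ s

lin : ℤ² → ℤ² → ℤ² → ℤ²
lin v x (a , b) = a · v ⊕ b · x

e₂ : ℤ²
e₂ = + 0 , + 1

lin-e₂ : ∀ v x → lin v x e₂ ≡ x
lin-e₂ (v₁ , v₂) (x₁ , x₂) = cong₂ _,_ (component v₁ x₁) (component v₂ x₂)
  where
  component : ∀ v x → + 0 *ᶻ v +ᶻ + 1 *ᶻ x ≡ x
  component = solve-∀

lin-scale : ∀ v x s c → lin v x (s · c) ≡ s · lin v x c
lin-scale (v₁ , v₂) (x₁ , x₂) s (a , b) = cong₂ _,_ (component s a b v₁ x₁) (component s a b v₂ x₂)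
  where
  component : ∀ s a b v x → (s *ᶻ a) *ᶻ v +ᶻ (s *ᶻ b) *ᶻ x ≡ s *ᶻ (a *ᶻ v +ᶻ b *ᶻ x)
  component = solve-∀

lin-lin : ∀ v x d c e → lin v x (lin d c e) ≡ lin (lin v x d) (lin v x c) e
lin-lin (v₁ , v₂) (x₁ , x₂) (d₁ , d₂) (c₁ , c₂) (a , b) =
  cong₂ _,_ (component a b d₁ d₂ c₁ c₂ v₁ x₁) (component a b d₁ d₂ c₁ c₂ v₂ x₂)
  where
  component : ∀ a b d₁ d₂ c₁ c₂ v x → (a *ᶻ d₁ +ᶻ b *ᶻ c₁) *ᶻ v +ᶻ (a *ᶻ d₂ +ᶻ b *ᶻ c₂) *ᶻ x
                    ≡ a *ᶻ (d₁ *ᶻ v +ᶻ d₂ *ᶻ x) +ᶻ b *ᶻ (c₁ *ᶻ v +ᶻ c₂ *ᶻ x)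
  component = solve-∀

cross-lin : ∀ v x c c' → cross (lin v x c) (lin v x c') ≡ cross c c' *ᶻ cross x v
cross-lin (v₁ , v₂) (x₁ , x₂) (a , b) (c , d) = identity v₁ v₂ x₁ x₂ a b c d
  where
  identity : ∀ v₁ v₂ x₁ x₂ a b c d →
    (a *ᶻ v₂ +ᶻ b *ᶻ x₂) *ᶻ (c *ᶻ v₁ +ᶻ d *ᶻ x₁) -ᶻ (a *ᶻ v₁ +ᶻ b *ᶻ x₁) *ᶻ (c *ᶻ v₂ +ᶻ d *ᶻ x₂)
      ≡ (b *ᶻ c -ᶻ a *ᶻ d) *ᶻ (x₂ *ᶻ v₁ -ᶻ x₁ *ᶻ v₂)
  identity = solve-∀

cross-unimodular : ∀ v x c c' → cross x v ≡ + 1 → cross c c' ≡ + 1 → cross (lin v x c) (lin v x c') ≡ + 1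
cross-unimodular v x c c' xv cc' = begin
  cross (lin v x c) (lin v x c') ≡⟨ cross-lin v x c c' ⟩
  cross c c' *ᶻ cross x v        ≡⟨ cong₂ _*ᶻ_ cc' xv ⟩
  + 1                            ∎

ι : Frac → ℤ²
ι (p , q) = + p , + q

ι-2x+y : ∀ x y → ι (2 * proj₁ x + proj₁ y , 2 * proj₂ x + proj₂ y) ≡ lin (ι y) (ι x) (+ 1 , + 2)
ι-2x+y (p , q) (r , s) = cong₂ _,_ (component p r) (component q s)
  where
  rearrange : ∀ a b → + 2 *ᶻ a +ᶻ b ≡ + 1 *ᶻ b +ᶻ + 2 *ᶻ a
  rearrange = solve-∀
  component : ∀ p r → + (2 * p + r) ≡ + 1 *ᶻ + r +ᶻ + 2 *ᶻ + p
  component p r = begin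
    + (2 * p + r)            ≡⟨ pos-+ (2 * p) r ⟩
    + (2 * p) +ᶻ + r         ≡⟨ cong (_+ᶻ + r) (pos-* 2 p) ⟩
    + 2 *ᶻ + p +ᶻ + r        ≡⟨ rearrange (+ p) (+ r) ⟩
    + 1 *ᶻ + r +ᶻ + 2 *ᶻ + p ∎

ι-x+2y : ∀ x y → ι (proj₁ x + 2 * proj₁ y , proj₂ x + 2 * proj₂ y) ≡ lin (ι y) (ι x) (+ 2 , + 1)
ι-x+2y (p , q) (r , s) = cong₂ _,_ (component p r) (component q s)
  where
  rearrange : ∀ a b → a +ᶻ + 2 *ᶻ b ≡ + 2 *ᶻ b +ᶻ + 1 *ᶻ a
  rearrange = solve-∀
  component : ∀ p r → + (p + 2 * r) ≡ + 2 *ᶻ + r +ᶻ + 1 *ᶻ + p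
  component p r = begin
    + (p + 2 * r)            ≡⟨ pos-+ p (2 * r) ⟩
    + p +ᶻ + (2 * r)         ≡⟨ cong (+ p +ᶻ_) (pos-* 2 r) ⟩
    + p +ᶻ + 2 *ᶻ + r        ≡⟨ rearrange (+ p) (+ r) ⟩
    + 2 *ᶻ + r +ᶻ + 1 *ᶻ + p ∎

coprime-of-cross : ∀ a b u → cross (+ a , + b) u ≡ + 1 → gcd a b ≡ 1
coprime-of-cross a b (u₁ , u₂) unimodular = ∣1⇒≡1 (∣⇒∣ᵤ (subst (+ gcd a b ∣_) unimodular
  (∣m∣n⇒∣m-n (∣m⇒∣m*n u₁ (∣ᵤ⇒∣ {i = + b} (gcd[m,n]∣n a b)))
             (∣m⇒∣m*n u₂ (∣ᵤ⇒∣ {i = + a} (gcd[m,n]∣m a b))))))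

reduce-multiple : ∀ k a b → gcd a b ≡ 1 → reduce (suc k * a , suc k * b) ≡ (a , b)
reduce-multiple k a b coprime = cong₂ _,_ (cancel a) (cancel b)
  where
  gcd≡ : gcd (suc k * a) (suc k * b) ≡ suc k
  gcd≡ = begin
    gcd (suc k * a) (suc k * b) ≡⟨ c*gcd[m,n]≡gcd[cm,cn] (suc k) a b ⟨
    suc k * gcd a b             ≡⟨ cong (suc k *_) coprime ⟩
    suc k * 1                   ≡⟨ *-identityʳ (suc k) ⟩
    suc k                       ∎
  cancel : ∀ c → divBy (suc k * c) (gcd (suc k * a) (suc k * b)) ≡ c
  cancel c = begin
    divBy (suc k * c) (gcd (suc k * a) (suc k * b)) ≡⟨ cong (divBy (suc k * c)) gcd≡ ⟩
    suc k * c / suc k                               ≡⟨ cong (_/ suc k) (*-comm (suc k) c) ⟩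
    c * suc k / suc k                               ≡⟨ m*n/n≡m c (suc k) ⟩
    c                                               ∎

ι-reduce : ∀ z k w u → ι z ≡ + suc k · w → cross w u ≡ + 1 → ι (reduce z) ≡ w
ι-reduce (m , n) k (+ a , + b) u scaled unimodular
  rewrite +-injective (trans (cong proj₁ scaled) (sym (pos-* (suc k) a)))
        | +-injective (trans (cong proj₂ scaled) (sym (pos-* (suc k) b)))
  = cong ι (reduce-multiple k a b (coprime-of-cross a b u unimodular))
ι-reduce (m , n) k (+ a , -[1+ b ]) u scaled _ with cong proj₂ scaled
... | ()
ι-reduce (m , n) k (-[1+ a ] , w₂) u scaled _ with cong proj₁ scaled
... | ()

record Framed (e : ℤ²) (x y : Frac) : Set where
  constructor framed
  field
    v           : ℤ²
    unimodular  : cross (ι x) v ≡ + 1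
    coordinates : ι y ≡ lin v (ι x) e

cross-framed : ∀ {e x y} → Framed e x y → cross (ι x) (ι y) ≡ cross e₂ e
cross-framed {e} {x} {y} (framed v unimodular coordinates) = begin
  cross (ι x) (ι y)                     ≡⟨ cong₂ cross (sym (lin-e₂ v (ι x))) coordinates ⟩
  cross (lin v (ι x) e₂) (lin v (ι x) e) ≡⟨ cross-lin v (ι x) e₂ e ⟩
  cross e₂ e *ᶻ cross (ι x) v           ≡⟨ cong (cross e₂ e *ᶻ_) unimodular ⟩
  cross e₂ e *ᶻ + 1                     ≡⟨ *ᶻ-identityʳ (cross e₂ e) ⟩
  cross e₂ e                            ∎

framed-by-coordinates : ∀ {v x u w e} c d → cross x v ≡ + 1 → cross c d ≡ + 1 →
  ι u ≡ lin v x c → ι w ≡ lin v x (lin d c e) → Framed e u w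
framed-by-coordinates {v} {x} {u} {w} {e} c d xv cd ι-u ι-w = framed (lin v x d) unimodular coordinates
  where
  unimodular : cross (ι u) (lin v x d) ≡ + 1
  unimodular = trans (cong (λ z → cross z (lin v x d)) ι-u) (cross-unimodular v x c d xv cd)
  coordinates : ι w ≡ lin (lin v x d) (ι u) e
  coordinates = begin
    ι w                             ≡⟨ ι-w ⟩
    lin v x (lin d c e)             ≡⟨ lin-lin v x d c e ⟩
    lin (lin v x d) (lin v x c) e   ≡⟨ cong (λ z → lin (lin v x d) z e) ι-u ⟨
    lin (lin v x d) (ι u) e         ∎

-- The refinement of the standard pair (e₂ , y): the inserted vectors y + 2 e₂ and 2 y + e₂ are
-- positive multiples of l and r, and d₁, d₂, d₃ frame the pairs (e₂ , l), (l , r), (r , y) with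
-- endpoints y₁, y₂, y₃.
record Refinement (y y₁ y₂ y₃ : ℤ²) : Set where
  field
    l r d₁ d₂ d₃   : ℤ²
    kₗ kᵣ          : ℕ
    left-multiple  : lin y e₂ (+ 1 , + 2) ≡ + suc kₗ · l
    right-multiple : lin y e₂ (+ 2 , + 1) ≡ + suc kᵣ · r
    unimodular₁    : cross e₂ d₁ ≡ + 1
    unimodular₂    : cross l d₂ ≡ + 1
    unimodular₃    : cross r d₃ ≡ + 1
    coordinates₁   : l ≡ lin d₁ e₂ y₁
    coordinates₂   : r ≡ lin d₂ l y₂
    coordinates₃   : y ≡ lin d₃ r y₃

refine-framed : ∀ {y y₁ y₂ y₃ a b} → Refinement y y₁ y₂ y₃ → Framed y a b →
  Framed y₁ a (left a b) × Framed y₂ (left a b) (right a b) × Framed y₃ (right a b) b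
refine-framed {y} {y₁} {y₂} {y₃} {a} {b} ref (framed v unimodular coordinates) =
  framed-by-coordinates e₂ d₁ unimodular unimodular₁ ι-a (trans ι-l (cong F coordinates₁)) ,
  framed-by-coordinates l d₂ unimodular unimodular₂ ι-l (trans ι-r (cong F coordinates₂)) ,
  framed-by-coordinates r d₃ unimodular unimodular₃ ι-r (trans coordinates (cong F coordinates₃))
  where
  open Refinement ref
  F : ℤ² → ℤ²
  F = lin v (ι a)
  ι-a : ι a ≡ F e₂
  ι-a = sym (lin-e₂ v (ι a))
  inserted : ∀ c → lin (ι b) (ι a) c ≡ F (lin y e₂ c)
  inserted c = begin
    lin (ι b) (ι a) c     ≡⟨ cong₂ (λ p q → lin p q c) coordinates ι-a ⟩
    lin (F y) (F e₂) c    ≡⟨ lin-lin v (ι a) y e₂ c ⟨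
    F (lin y e₂ c)        ∎
  ι-l : ι (left a b) ≡ F l
  ι-l = ι-reduce _ kₗ (F l) (F d₂)
    (begin
      ι (2 * proj₁ a + proj₁ b , 2 * proj₂ a + proj₂ b) ≡⟨ ι-2x+y a b ⟩
      lin (ι b) (ι a) (+ 1 , + 2)                       ≡⟨ inserted (+ 1 , + 2) ⟩
      F (lin y e₂ (+ 1 , + 2))                          ≡⟨ cong F left-multiple ⟩
      F (+ suc kₗ · l)                                  ≡⟨ lin-scale v (ι a) (+ suc kₗ) l ⟩
      + suc kₗ · F l                                    ∎)
    (cross-unimodular v (ι a) l d₂ unimodular unimodular₂)
  ι-r : ι (right a b) ≡ F r
  ι-r = ι-reduce _ kᵣ (F r) (F d₃)
    (begin
      ι (proj₁ a + 2 * proj₁ b , proj₂ a + 2 * proj₂ b) ≡⟨ ι-x+2y a b ⟩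
      lin (ι b) (ι a) (+ 2 , + 1)                       ≡⟨ inserted (+ 2 , + 1) ⟩
      F (lin y e₂ (+ 2 , + 1))                          ≡⟨ cong F right-multiple ⟩
      F (+ suc kᵣ · r)                                  ≡⟨ lin-scale v (ι a) (+ suc kᵣ) r ⟩
      + suc kᵣ · F r                                    ∎)
    (cross-unimodular v (ι a) r d₃ unimodular unimodular₃)

cross-e₂ : ∀ m s → cross e₂ (m , s) ≡ m
cross-e₂ = identity
  where
  identity : ∀ m s → + 1 *ᶻ m -ᶻ + 0 *ᶻ s ≡ m
  identity = solve-∀

-- With cross x v = 1, shape plus k means y = x + 3^k v and shape minus k means y = - x + 3^(k+1) v.
data Shape : Set where
  plus minus : ℕ → Shape

modulus : Shape → ℕ
modulus (plus k)  = 3 ^ k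
modulus (minus k) = 3 ^ suc k

sign : Shape → ℤ
sign (plus _)  = + 1
sign (minus _) = -1ℤ

endpoint : Shape → ℤ²
endpoint τ = + modulus τ , sign τ

HasShape : Shape → Frac → Frac → Set
HasShape τ = Framed (endpoint τ)

cross-shape : ∀ τ {x y} → HasShape τ x y → cross (ι x) (ι y) ≡ + modulus τ
cross-shape τ s = trans (cross-framed s) (cross-e₂ (+ modulus τ) (sign τ))

cross-shear : ∀ a → cross (a , + 1) (+ 1 , + 0) ≡ + 1
cross-shear = identity
  where
  identity : ∀ a → + 1 *ᶻ + 1 -ᶻ a *ᶻ + 0 ≡ + 1
  identity = solve-∀

lin-shear : ∀ m s a b → lin (+ 1 , + 0) (a , b) (m , s) ≡ (m +ᶻ s *ᶻ a , s *ᶻ b)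
lin-shear m s a b = cong₂ _,_ (first m s a) (second m s b)
  where
  first : ∀ m s a → m *ᶻ + 1 +ᶻ s *ᶻ a ≡ m +ᶻ s *ᶻ a
  first = solve-∀
  second : ∀ m s b → m *ᶻ + 0 +ᶻ s *ᶻ b ≡ s *ᶻ b
  second = solve-∀

plus-refinement : ∀ μ → Refinement (+ 3 *ᶻ μ , + 1) (μ , + 1) (μ , + 1) (μ , + 1)
plus-refinement μ = record
  { l = μ , + 1 ; r = + 2 *ᶻ μ , + 1
  ; d₁ = + 1 , + 0 ; d₂ = + 1 , + 0 ; d₃ = + 1 , + 0
  ; kₗ = 2 ; kᵣ = 2
  ; left-multiple = cong (_, + 3) (left-identity μ)
  ; right-multiple = cong (_, + 3) (right-identity μ)
  ; unimodular₁ = refl ; unimodular₂ = cross-shear μ ; unimodular₃ = cross-shear (+ 2 *ᶻ μ)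
  ; coordinates₁ = sym (trans (lin-shear μ (+ 1) (+ 0) (+ 1)) (cong (_, + 1) (one μ)))
  ; coordinates₂ = sym (trans (lin-shear μ (+ 1) μ (+ 1)) (cong (_, + 1) (two μ)))
  ; coordinates₃ = sym (trans (lin-shear μ (+ 1) (+ 2 *ᶻ μ) (+ 1)) (cong (_, + 1) (three μ)))
  }
  where
  left-identity : ∀ μ → + 1 *ᶻ (+ 3 *ᶻ μ) +ᶻ + 2 *ᶻ + 0 ≡ + 3 *ᶻ μ
  left-identity = solve-∀
  right-identity : ∀ μ → + 2 *ᶻ (+ 3 *ᶻ μ) +ᶻ + 1 *ᶻ + 0 ≡ + 3 *ᶻ (+ 2 *ᶻ μ)
  right-identity = solve-∀
  one : ∀ μ → μ +ᶻ + 1 *ᶻ + 0 ≡ μ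
  one = solve-∀
  two : ∀ μ → μ +ᶻ + 1 *ᶻ μ ≡ + 2 *ᶻ μ
  two = solve-∀
  three : ∀ μ → μ +ᶻ + 1 *ᶻ (+ 2 *ᶻ μ) ≡ + 3 *ᶻ μ
  three = solve-∀

minus-refinement : ∀ M → Refinement (M , -1ℤ) (M , + 1) (+ 3 *ᶻ M , -1ℤ) (M , + 1)
minus-refinement M = record
  { l = M , + 1 ; r = + 2 *ᶻ M , -1ℤ
  ; d₁ = + 1 , + 0 ; d₂ = + 1 , + 0 ; d₃ = -1ℤ , + 0
  ; kₗ = 0 ; kᵣ = 0
  ; left-multiple = cong (_, + 1) (left-identity M)
  ; right-multiple = cong (_, -1ℤ) (right-identity M)
  ; unimodular₁ = refl ; unimodular₂ = cross-shear M ; unimodular₃ = last-unimodular M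
  ; coordinates₁ = sym (trans (lin-shear M (+ 1) (+ 0) (+ 1)) (cong (_, + 1) (one M)))
  ; coordinates₂ = sym (trans (lin-shear (+ 3 *ᶻ M) -1ℤ M (+ 1)) (cong (_, -1ℤ) (two M)))
  ; coordinates₃ = cong₂ _,_ (last-first M) (last-second M)
  }
  where
  left-identity : ∀ M → + 1 *ᶻ M +ᶻ + 2 *ᶻ + 0 ≡ + 1 *ᶻ M
  left-identity = solve-∀
  right-identity : ∀ M → + 2 *ᶻ M +ᶻ + 1 *ᶻ + 0 ≡ + 1 *ᶻ (+ 2 *ᶻ M)
  right-identity = solve-∀
  last-unimodular : ∀ M → -1ℤ *ᶻ -1ℤ -ᶻ (+ 2 *ᶻ M) *ᶻ + 0 ≡ + 1
  last-unimodular = solve-∀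
  one : ∀ M → M +ᶻ + 1 *ᶻ + 0 ≡ M
  one = solve-∀
  two : ∀ M → + 3 *ᶻ M +ᶻ -1ℤ *ᶻ M ≡ + 2 *ᶻ M
  two = solve-∀
  last-first : ∀ M → M ≡ M *ᶻ -1ℤ +ᶻ + 1 *ᶻ (+ 2 *ᶻ M)
  last-first = solve-∀
  last-second : ∀ M → -1ℤ ≡ M *ᶻ + 0 +ᶻ + 1 *ᶻ -1ℤ
  last-second = solve-∀

outer : Shape → ℕ
outer (plus zero)    = 0
outer (plus (suc k)) = k
outer (minus k)      = suc k

inner : Shape → Shape
inner (plus zero)    = minus 0
inner (plus (suc k)) = plus k
inner (minus k)      = minus (suc k)

refinement : ∀ τ → Refinement (endpoint τ) (endpoint (plus (outer τ))) (endpoint (inner τ)) (endpoint (plus (outer τ)))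
refinement (plus zero) = record
  { l = + 1 , + 3 ; r = + 2 , + 3
  ; d₁ = + 1 , + 2 ; d₂ = + 1 , + 2 ; d₃ = -1ℤ , -[1+ 1 ]
  ; kₗ = 0 ; kᵣ = 0
  ; left-multiple = refl ; right-multiple = refl
  ; unimodular₁ = refl ; unimodular₂ = refl ; unimodular₃ = refl
  ; coordinates₁ = refl ; coordinates₂ = refl ; coordinates₃ = refl
  }
refinement (plus (suc k)) =
  subst (λ y → Refinement y (endpoint (plus k)) (endpoint (plus k)) (endpoint (plus k)))
        (cong (_, + 1) (sym (pos-* 3 (3 ^ k))))
        (plus-refinement (+ 3 ^ k))
refinement (minus k) =
  subst (λ y₂ → Refinement (endpoint (minus k)) (endpoint (plus (suc k))) y₂ (endpoint (plus (suc k))))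
        (cong (_, -1ℤ) (sym (pos-* 3 (3 ^ suc k))))
        (minus-refinement (+ 3 ^ suc k))

refine-shape : ∀ {τ x y} → HasShape τ x y →
  HasShape (plus (outer τ)) x (left x y) ×
  HasShape (inner τ) (left x y) (right x y) ×
  HasShape (plus (outer τ)) (right x y) y
refine-shape {τ} = refine-framed (refinement τ)

Compatible : Shape → Shape → Set
Compatible (plus _)  (plus _)  = ⊤
Compatible (plus j)  (minus k) = j ≡ k
Compatible (minus j) (plus k)  = j ≡ k
Compatible (minus _) (minus _) = ⊥

minus-flanked-left : ∀ {ρ k} → Compatible ρ (minus k) → ρ ≡ plus k
minus-flanked-left {plus _} refl = refl

minus-flanked-right : ∀ {ρ k} → Compatible (minus k) ρ → ρ ≡ plus k
minus-flanked-right {plus _} refl = refl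

inner-compatible : ∀ τ → Compatible (plus (outer τ)) (inner τ) × Compatible (inner τ) (plus (outer τ))
inner-compatible (plus zero)    = refl , refl
inner-compatible (plus (suc k)) = tt , tt
inner-compatible (minus k)      = refl , refl

infixr 5 _∷⟨_⟩_

data Chain : Shape → List Frac → Set where
  [_]     : ∀ {τ x y} → HasShape τ x y → Chain τ (x ∷ y ∷ [])
  _∷⟨_⟩_ : ∀ {τ σ x y ys} → HasShape τ x y → Compatible τ σ → Chain σ (y ∷ ys) → Chain τ (x ∷ y ∷ ys)

subdivide : ∀ {τ x y zs} → HasShape τ x y → Chain (plus (outer τ)) (right x y ∷ zs) →
  Chain (plus (outer τ)) (x ∷ left x y ∷ right x y ∷ zs)
subdivide {τ} s rest =
  proj₁ (refine-shape s) ∷⟨ proj₁ (inner-compatible τ) ⟩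
  proj₁ (proj₂ (refine-shape s)) ∷⟨ proj₂ (inner-compatible τ) ⟩
  rest

refine-chain : ∀ {τ L} → Chain τ L → Chain (plus (outer τ)) (refine L)
-- The tail is split only so that refine (y ∷ ys) computes to a list starting with y.
refine-chain [ s ]                     = subdivide s [ proj₂ (proj₂ (refine-shape s)) ]
refine-chain (s ∷⟨ _ ⟩ ch@([ _ ]))       = subdivide s (proj₂ (proj₂ (refine-shape s)) ∷⟨ tt ⟩ refine-chain ch)
refine-chain (s ∷⟨ _ ⟩ ch@(_ ∷⟨ _ ⟩ _)) = subdivide s (proj₂ (proj₂ (refine-shape s)) ∷⟨ tt ⟩ refine-chain ch)

SB-chain : ∀ n → Chain (plus 0) (SB n)
SB-chain zero    = [ framed (+ 1 , + 0) refl refl ]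
SB-chain (suc n) = refine-chain (SB-chain n)

shapeAt : ∀ {τ L} → Chain τ L → ℕ → Shape
shapeAt {τ} [ _ ]         _       = τ
shapeAt {τ} (_ ∷⟨ _ ⟩ _)  zero    = τ
shapeAt     (_ ∷⟨ _ ⟩ ch) (suc i) = shapeAt ch i

shape-at : ∀ {τ L} (ch : Chain τ L) i → suc i < length L → HasShape (shapeAt ch i) (nth L i) (nth L (suc i))
shape-at [ s ]         zero    _         = s
shape-at [ s ]         (suc i) (s≤s (s≤s ()))
shape-at (s ∷⟨ _ ⟩ _)  zero    _         = s
shape-at (_ ∷⟨ _ ⟩ ch) (suc i) (s≤s i<) = shape-at ch i i<

compatible-at : ∀ {τ L} (ch : Chain τ L) i → suc (suc i) < length L →
  Compatible (shapeAt ch i) (shapeAt ch (suc i))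
compatible-at [ _ ]                   i       (s≤s (s≤s ()))
compatible-at (_ ∷⟨ c ⟩ [ _ ])        zero    _         = c
compatible-at (_ ∷⟨ c ⟩ (_ ∷⟨ _ ⟩ _)) zero    _         = c
compatible-at (_ ∷⟨ _ ⟩ ch)           (suc i) (s≤s i<) = compatible-at ch i i<

length-refine : ∀ x L → length (refine (x ∷ L)) ≡ suc (3 * length L)
length-refine x []      = refl
length-refine x (y ∷ L) = begin
  3 + length (refine (y ∷ L)) ≡⟨ cong (λ m → 3 + m) (length-refine y L) ⟩
  3 + suc (3 * length L)      ≡⟨ cong suc (*-suc 3 (length L)) ⟨
  suc (3 * suc (length L))    ∎

length-SB : ∀ n → length (SB n) ≡ suc (3 ^ n)
length-SB zero = refl
length-SB (suc n) with SB n | length-SB n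
... | x ∷ L | length≡ = trans (length-refine x L) (cong (λ m → suc (3 * m)) (suc-injective length≡))

subdivision : Frac → Frac → List Frac
subdivision x y = x ∷ left x y ∷ right x y ∷ y ∷ []

nth-refine : ∀ L i r → r ≤ 3 → suc i < length L →
  nth (refine L) (3 * i + r) ≡ nth (subdivision (nth L i) (nth L (suc i))) r
nth-refine (x ∷ y ∷ ys) zero zero                      _ _ = refl
nth-refine (x ∷ y ∷ ys) zero (suc zero)                _ _ = refl
nth-refine (x ∷ y ∷ ys) zero (suc (suc zero))          _ _ = refl
nth-refine (x ∷ y ∷ [])     zero (suc (suc (suc zero))) _ _ = refl
nth-refine (x ∷ y ∷ _ ∷ _)  zero (suc (suc (suc zero))) _ _ = refl
nth-refine (x ∷ y ∷ ys) zero (suc (suc (suc (suc _)))) (s≤s (s≤s (s≤s ()))) _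
nth-refine (x ∷ y ∷ ys) (suc i) r r≤3 (s≤s i<) = begin
  nth (refine (x ∷ y ∷ ys)) (3 * suc i + r) ≡⟨ cong (nth (refine (x ∷ y ∷ ys))) (regroup i) ⟩
  nth (refine (x ∷ y ∷ ys)) (3 + (3 * i + r)) ≡⟨ nth-refine (y ∷ ys) i r r≤3 i< ⟩
  nth (subdivision (nth (y ∷ ys) i) (nth (y ∷ ys) (suc i))) r ∎
  where
  regroup : ∀ i → 3 * suc i + r ≡ 3 + (3 * i + r)
  regroup i = trans (cong (_+ r) (*-suc 3 i)) (+-assoc 3 (3 * i) r)
nth-refine (x ∷ []) i r _ (s≤s ())

C-cross : ∀ n i → C n i ≡ cross (ι (nth (SB n) i)) (ι (nth (SB n) (suc i)))
C-cross n i = cong₂ _-ᶻ_ (pos-* (proj₂ x) (proj₁ y)) (pos-* (proj₁ x) (proj₂ y))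
  where
  x y : Frac
  x = nth (SB n) i
  y = nth (SB n) (suc i)

in-range : ∀ n i → i < 3 ^ n → suc i < length (SB n)
in-range n i i<3ⁿ = subst (suc i <_) (sym (length-SB n)) (s≤s i<3ⁿ)

shape-in-SB : ∀ {σ} n i → i < 3 ^ n → shapeAt (SB-chain n) i ≡ σ →
  HasShape σ (nth (SB n) i) (nth (SB n) (suc i))
shape-in-SB n i i<3ⁿ refl = shape-at (SB-chain n) i (in-range n i i<3ⁿ)

C-at : ∀ {σ} n i → i < 3 ^ n → shapeAt (SB-chain n) i ≡ σ → C n i ≡ + modulus σ
C-at {σ} n i i<3ⁿ shape≡ = trans (C-cross n i) (cross-shape σ (shape-in-SB n i i<3ⁿ shape≡))

C-subdivision : ∀ n i r → r < 3 → i < 3 ^ n →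
  let W = subdivision (nth (SB n) i) (nth (SB n) (suc i)) in
  C (suc n) (3 * i + r) ≡ cross (ι (nth W r)) (ι (nth W (suc r)))
C-subdivision n i r r<3 i<3ⁿ = begin
  C (suc n) (3 * i + r)
    ≡⟨ C-cross (suc n) (3 * i + r) ⟩
  cross (ι (nth (refine L) (3 * i + r))) (ι (nth (refine L) (suc (3 * i + r))))
    ≡⟨ cong₂ (λ a b → cross (ι a) (ι b))
             (nth-refine L i r (<⇒≤ r<3) (in-range n i i<3ⁿ))
             (trans (cong (nth (refine L)) (sym (+-suc (3 * i) r)))
                    (nth-refine L i (suc r) r<3 (in-range n i i<3ⁿ))) ⟩
  cross (ι (nth W r)) (ι (nth W (suc r)))
    ∎
  where
  L W : List Frac
  L = SB n
  W = subdivision (nth L i) (nth L (suc i))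

C-children : ∀ τ n i → i < 3 ^ n → HasShape τ (nth (SB n) i) (nth (SB n) (suc i)) →
  C (suc n) (3 * i) ≡ + modulus (plus (outer τ)) ×
  C (suc n) (3 * i + 1) ≡ + modulus (inner τ) ×
  C (suc n) (3 * i + 2) ≡ + modulus (plus (outer τ))
C-children τ n i i<3ⁿ s =
  let s₁ , s₂ , s₃ = refine-shape s in
  trans (cong (C (suc n)) (sym (+-identityʳ (3 * i))))
        (trans (C-subdivision n i 0 (s≤s z≤n) i<3ⁿ) (cross-shape (plus (outer τ)) s₁)) ,
  trans (C-subdivision n i 1 (s≤s (s≤s z≤n)) i<3ⁿ) (cross-shape (inner τ) s₂) ,
  trans (C-subdivision n i 2 (s≤s (s≤s (s≤s z≤n))) i<3ⁿ) (cross-shape (plus (outer τ)) s₃)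

minus-strict-max : ∀ {k} n i → i < 3 ^ n → shapeAt (SB-chain n) i ≡ minus k → StrictLocalMax n i
minus-strict-max {k} n i i<3ⁿ shape≡ = left-smaller , right-smaller
  where
  ch : Chain (plus 0) (SB n)
  ch = SB-chain n
  below-peak : ∀ {j} → C n j ≡ + (3 ^ k) → C n j ℤ.< C n i
  below-peak eq = subst₂ ℤ._<_ (sym eq) (sym (C-at n i i<3ⁿ shape≡))
                         (ℤ.+<+ (^-monoʳ-< 3 (s≤s (s≤s z≤n)) (n<1+n k)))
  left-smaller : ∀ j → suc j ≡ i → C n j ℤ.< C n i
  left-smaller j sj≡i = below-peak (C-at n j j<3ⁿ (minus-flanked-left compatible))
    where
    sj<3ⁿ : suc j < 3 ^ n
    sj<3ⁿ = subst (_< 3 ^ n) (sym sj≡i) i<3ⁿ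
    j<3ⁿ : j < 3 ^ n
    j<3ⁿ = <-trans (n<1+n j) sj<3ⁿ
    compatible : Compatible (shapeAt ch j) (minus k)
    compatible = subst (Compatible (shapeAt ch j)) (trans (cong (shapeAt ch) sj≡i) shape≡)
                       (compatible-at ch j (in-range n (suc j) sj<3ⁿ))
  right-smaller : suc i < 3 ^ n → C n (suc i) ℤ.< C n i
  right-smaller si<3ⁿ = below-peak (C-at n (suc i) si<3ⁿ (minus-flanked-right compatible))
    where
    compatible : Compatible (minus k) (shapeAt ch (suc i))
    compatible = subst (λ σ → Compatible σ (shapeAt ch (suc i))) shape≡
                       (compatible-at ch i (in-range n (suc i) si<3ⁿ))

lemma14 : (n i : ℕ) → i < 3 ^ n → C n i ≢ + 1 → ¬ StrictLocalMax n i →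
    ((+ 3) ℤ.* C (n + 1) (3 * i) ≡ C n i) ×
    ((+ 3) ℤ.* C (n + 1) (3 * i + 1) ≡ C n i) ×
    ((+ 3) ℤ.* C (n + 1) (3 * i + 2) ≡ C n i)
lemma14 n i i<3ⁿ C≢1 ¬max with shapeAt (SB-chain n) i in shape≡
... | plus zero    = ⊥-elim (C≢1 (C-at n i i<3ⁿ shape≡))
... | minus k      = ⊥-elim (¬max (minus-strict-max n i i<3ⁿ shape≡))
... | plus (suc k) =
  let C₀ , C₁ , C₂ = C-children (plus (suc k)) n i i<3ⁿ (shape-in-SB n i i<3ⁿ shape≡)
  in  third C₀ , third C₁ , third C₂
  where
  third : ∀ {j} → C (suc n) j ≡ + (3 ^ k) → (+ 3) ℤ.* C (n + 1) j ≡ C n i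
  third {j} child = begin
    + 3 ℤ.* C (n + 1) j   ≡⟨ cong (λ m → + 3 ℤ.* C m j) (+-comm n 1) ⟩
    + 3 ℤ.* C (suc n) j   ≡⟨ cong (+ 3 ℤ.*_) child ⟩
    + 3 ℤ.* + (3 ^ k)     ≡⟨ pos-* 3 (3 ^ k) ⟨
    + (3 ^ suc k)         ≡⟨ C-at n i i<3ⁿ shape≡ ⟨
    C n i                 ∎
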